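{- Let $G$ be a finite abelian group and let $A_1,\dots,A_m$ be a bimodal collection of pairwise disjoint nonempty subsets of $G$. Then for each $i$ and each $x\in H_i\setminus\{0\}$, $N_i(x)=0$.
   Context: $G$ is written additively, $G^*=G\setminus\{0\}$, $k_j=|A_j|$. For $\delta\in G^*$, $N_j(\delta)=|\{(a,b): a\in A_j,\ b\in A_i \text{ for some } i\neq j,\ a-b=\delta\}|$. The collection is bimodal if $N_j(\delta)\in\{0,k_j\}$ for all $\delta\in G^*$ and all $j$. $H_i$ is the subgroup of $G$ generated by $\{g_1-g_2: g_1,g_2\in A_i,\ g_1\neq g_2\}$. -}

module Defs where

open import Level using (Level; _⊔_)
open import Algebra.Bundles using (AbelianGroup)
open import Data.Nat using (ℕ)
open import Data.Fin using (Fin)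
open import Data.Fin.Properties using () renaming (_≟_ to _≟ᶠ_)
open import Data.List using (List; []; length; filter; concatMap; map; allFin)
open import Data.List.Relation.Unary.AllPairs using (AllPairs)
open import Data.Product using (_×_; _,_; proj₁; proj₂)
open import Relation.Nullary using (¬_; Dec; yes; no)
open import Relation.Binary.PropositionalEquality using (_≡_)
open import Relation.Binary.Definitions using (Decidable)
import Data.List.Membership.Setoid as SetoidMembership

-- (The group operation _∙_ is written additively in the paper: a - b = a ∙ b ⁻¹, 0 = ε.)
-- A finite abelian group with decidable equality, given with a list
-- enumerating all of its elements.
record FiniteAbelianGroup (c ℓ : Level) : Set (Level.suc (c ⊔ ℓ)) where
  field
    abelianGroup : AbelianGroup c ℓ
  open AbelianGroup abelianGroup public
  open SetoidMembership setoid public using (_∈_)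
  field
    _≈?_     : Decidable _≈_
    elements : List Carrier
    complete : ∀ x → x ∈ elements

module _ {c ℓ : Level} (G : FiniteAbelianGroup c ℓ) where
  open FiniteAbelianGroup G

  -- A finite subset of G, given as a duplicate-free list.
  IsSubsetList : List Carrier → Set (c ⊔ ℓ)
  IsSubsetList xs = AllPairs (λ a b → ¬ a ≈ b) xs

  NonEmpty : List Carrier → Set c
  NonEmpty xs = ¬ xs ≡ []

  PairwiseDisjoint : {m : ℕ} → (Fin m → List Carrier) → Set (c ⊔ ℓ)
  PairwiseDisjoint {m} A = ∀ i j → ¬ i ≡ j → ∀ x → x ∈ A i → ¬ x ∈ A j

  crossPairs : {m : ℕ} → (Fin m → List Carrier) → Fin m → List (Carrier × Carrier)
  crossPairs {m} A j =
    concatMap (λ a →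
      concatMap (λ i → helper i a) (allFin m)) (A j)
    where
    helper : Fin m → Carrier → List (Carrier × Carrier)
    helper i a with i ≟ᶠ j
    ... | yes _ = []
    ... | no _  = map (λ b → (a , b)) (A i)

  N : {m : ℕ} → (Fin m → List Carrier) → Fin m → Carrier → ℕ
  N A j δ = length (filter (λ p → (proj₁ p ∙ proj₂ p ⁻¹) ≈? δ) (crossPairs A j))

  Bimodal : {m : ℕ} → (Fin m → List Carrier) → Set (c ⊔ ℓ)
  Bimodal A = ∀ j δ → ¬ δ ≈ ε → (N A j δ ≡ 0) Data.Sum.⊎ (N A j δ ≡ length (A j))
    where import Data.Sum

  -- membership in H_i: the subgroup generated by differences of distinct
  -- elements of A_i
  data InH {m : ℕ} (A : Fin m → List Carrier) (i : Fin m) : Carrier → Set (c ⊔ ℓ) where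
    gen  : ∀ {x} g₁ g₂ → g₁ ∈ A i → g₂ ∈ A i → ¬ g₁ ≈ g₂ → x ≈ g₁ ∙ g₂ ⁻¹ → InH A i x
    zero : ∀ {x} → x ≈ ε → InH A i x
    add  : ∀ {x y z} → InH A i x → InH A i y → z ≈ x ∙ y → InH A i z
    neg  : ∀ {x z} → InH A i x → z ≈ x ⁻¹ → InH A i z

module Submission where

-- Let Bᵢ be the union of the blocks A_k with k ≠ i, so that N_i(δ) counts
-- the pairs (a , b) with a ∈ Aᵢ, b ∈ Bᵢ and a - b = δ.
--
--  1. Because the blocks are duplicate-free and pairwise disjoint, every
--     a ∈ A_j has at most one such partner b for a given δ; hence N_j(δ) is
--     a sum of k_j terms, each 0 or 1.
--  2. Bimodality then says: for δ ≠ 0, if one a ∈ A_j has a partner at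
--     difference δ, then every a ∈ A_j has one.
--  3. For g₁ , g₂ ∈ Aᵢ and y ∈ Bᵢ, the element g₂ has the partner y at
--     difference g₂ - y ≠ 0, so g₁ has a partner b with g₁ - b = g₂ - y,
--     i.e. y + (g₁ - g₂) = b ∈ Bᵢ.  So the translations by generators of
--     Hᵢ, and hence by all of Hᵢ, map Bᵢ into itself.
--  4. If N_i(x) ≠ 0 for some x ∈ Hᵢ there are a ∈ Aᵢ, b ∈ Bᵢ with a = b + x,
--     which then lies in Bᵢ, contradicting disjointness.

open import Defs
open import Level using (Level; _⊔_)
open import Algebra.Bundles using (AbelianGroup)
open import Data.Nat using (ℕ; _≤_; _<_; _+_; z≤n; s≤s)
open import Data.Nat.Properties using (+-mono-≤; +-mono-≤-<; <-irrefl)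
open import Data.Nat.ListAction using (sum)
open import Data.Fin using (Fin)
open import Data.Fin.Properties using () renaming (_≟_ to _≟ᶠ_)
open import Data.List using (List; []; _∷_; length; filter; concatMap; map; allFin)
open import Data.List.Properties using (filter-++; length-++; concatMap-cong; filter-none)
open import Data.List.Relation.Unary.Any as Any using (here; there; any?)
import Data.List.Relation.Unary.All as All
open import Data.List.Relation.Unary.All.Properties as AllProps using (¬Any⇒All¬)
open import Data.List.Relation.Unary.AllPairs as AllPairs using (AllPairs; _∷_)
import Data.List.Relation.Unary.AllPairs.Properties as AllPairs
open import Data.List.Relation.Unary.Unique.Propositional.Properties using (allFin⁺)
open import Data.List.Membership.Propositional using (find; lose) renaming (_∈_ to _∈ₚ_)
open import Data.List.Membership.Propositional.Properties
  using (∈-length; ∈-filter⁺; ∈-filter⁻; ∈-map⁺; ∈-map⁻; ∈-concatMap⁺; ∈-concatMap⁻; ∈-allFin)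
open import Data.Product using (Σ; ∃; _×_; _,_; proj₁; proj₂)
open import Data.Sum using (_⊎_; inj₁; inj₂)
open import Data.Empty using (⊥-elim)
open import Relation.Nullary using (¬_; Dec; yes; no)
open import Relation.Unary using (Decidable)
open import Relation.Binary.PropositionalEquality using (_≡_; refl; sym; trans; cong; subst)

filter-empty-or-witness : ∀ {a p} {X : Set a} {P : X → Set p} (P? : Decidable P) (xs : List X) →
  filter P? xs ≡ [] ⊎ ∃ λ x → x ∈ₚ xs × P x
filter-empty-or-witness P? xs with any? P? xs
... | yes some = inj₂ (find some)
... | no none  = inj₁ (filter-none P? (¬Any⇒All¬ xs none))

length-filter-concatMap : ∀ {a b p} {X : Set a} {Y : Set b} {P : Y → Set p}
  (P? : Decidable P) (f : X → List Y) (xs : List X) →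
  length (filter P? (concatMap f xs)) ≡ sum (map (λ x → length (filter P? (f x))) xs)
length-filter-concatMap P? f [] = refl
length-filter-concatMap P? f (x ∷ xs) =
  trans (cong length (filter-++ P? (f x) (concatMap f xs)))
    (trans (length-++ (filter P? (f x)))
      (cong (length (filter P? (f x)) +_) (length-filter-concatMap P? f xs)))

sum≤length : ∀ {a} {X : Set a} (g : X → ℕ) (xs : List X) →
  (∀ x → x ∈ₚ xs → g x ≤ 1) → sum (map g xs) ≤ length xs
sum≤length g [] _ = z≤n
sum≤length g (x ∷ xs) g≤1 =
  +-mono-≤ (g≤1 x (here refl)) (sum≤length g xs (λ y y∈ → g≤1 y (there y∈)))

sum<length : ∀ {a} {X : Set a} (g : X → ℕ) (xs : List X) →
  (∀ x → x ∈ₚ xs → g x ≤ 1) → ∀ {x₀} → x₀ ∈ₚ xs → g x₀ ≡ 0 → sum (map g xs) < length xs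
sum<length g (x ∷ xs) g≤1 (here refl) gx≡0 rewrite gx≡0 =
  s≤s (sum≤length g xs (λ y y∈ → g≤1 y (there y∈)))
sum<length g (x ∷ xs) g≤1 (there x₀∈) gx₀≡0 =
  +-mono-≤-< (g≤1 x (here refl)) (sum<length g xs (λ y y∈ → g≤1 y (there y∈)) x₀∈ gx₀≡0)

length≤1 : ∀ {a r} {X : Set a} {R : X → X → Set r} (ys : List X) → AllPairs R ys →
  (∀ {u v} → u ∈ₚ ys → v ∈ₚ ys → ¬ R u v) → length ys ≤ 1
length≤1 [] _ _ = z≤n
length≤1 (u ∷ []) _ _ = s≤s z≤n
length≤1 (u ∷ v ∷ ys) ((Ruv All.∷ _) ∷ _) unrelated =
  ⊥-elim (unrelated (here refl) (there (here refl)) Ruv)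

module Differences {c ℓ : Level} (G : AbelianGroup c ℓ) where
  open AbelianGroup G
    using (_≈_; _∙_; _⁻¹; _-_; ε; group; commutativeMonoid; setoid; ∙-congˡ; inverseʳ; identityʳ)
    renaming (refl to ≈-refl; sym to ≈-sym)
  open import Algebra.Properties.Group group using (∙-cancelˡ; ⁻¹-injective; x∙y⁻¹≈ε⇒x≈y)
  open import Algebra.Properties.AbelianGroup G using (⁻¹-anti-homo‿-)
  open import Algebra.Solver.CommutativeMonoid commutativeMonoid using (solve; _⊜_; _⊕_)
  open import Relation.Binary.Reasoning.Setoid setoid

  difference-injective : ∀ a {b b′} → a - b ≈ a - b′ → b ≈ b′
  difference-injective a eq = ⁻¹-injective (∙-cancelˡ a _ _ eq)

  add-difference : ∀ {a b x} → a - b ≈ x → b ∙ x ≈ a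
  add-difference {a} {b} {x} a-b≈x = begin
    b ∙ x            ≈⟨ ∙-congˡ (≈-sym a-b≈x) ⟩
    b ∙ (a ∙ b ⁻¹)   ≈⟨ solve 3 (λ p q r → p ⊕ (q ⊕ r) ⊜ q ⊕ (p ⊕ r)) ≈-refl b a (b ⁻¹) ⟩
    a ∙ (b ∙ b ⁻¹)   ≈⟨ ∙-congˡ (inverseʳ b) ⟩
    a ∙ ε            ≈⟨ identityʳ a ⟩
    a                ∎

  equal-differences : ∀ {g₁ g₂ b y} → g₁ - b ≈ g₂ - y → y ∙ (g₁ - g₂) ≈ b
  equal-differences {g₁} {g₂} {b} {y} eq = x∙y⁻¹≈ε⇒x≈y _ _ (begin
    (y ∙ (g₁ ∙ g₂ ⁻¹)) ∙ b ⁻¹   ≈⟨ solve 4 (λ p q r s → (p ⊕ (q ⊕ r)) ⊕ s ⊜ (p ⊕ r) ⊕ (q ⊕ s))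
                                          ≈-refl y g₁ (g₂ ⁻¹) (b ⁻¹) ⟩
    (y - g₂) ∙ (g₁ - b)         ≈⟨ ∙-congˡ eq ⟩
    (y - g₂) ∙ (g₂ - y)         ≈⟨ ∙-congˡ (≈-sym (⁻¹-anti-homo‿- y g₂)) ⟩
    (y - g₂) ∙ (y - g₂) ⁻¹      ≈⟨ inverseʳ (y - g₂) ⟩
    ε                           ∎)

module Blocks {c ℓ : Level} (G : FiniteAbelianGroup c ℓ) {m : ℕ}
  (A : Fin m → List (FiniteAbelianGroup.Carrier G)) where
  open FiniteAbelianGroup G
    using (Carrier; _≈_; _∙_; _⁻¹; _-_; ε; _≈?_; abelianGroup; group;
           ∙-cong; ∙-congˡ; ⁻¹-cong; assoc; identityʳ)
    renaming (refl to ≈-refl; sym to ≈-sym; trans to ≈-trans; _∈_ to _∈ₛ_)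
  open import Algebra.Properties.Group group using (x∙y⁻¹≈ε⇒x≈y; ε⁻¹≈ε; ⁻¹-involutive)
  open import Algebra.Properties.AbelianGroup abelianGroup using (⁻¹-anti-homo‿-; ⁻¹-∙-comm)
  open Differences abelianGroup

  member : ∀ {y ys} → y ∈ₚ ys → y ∈ₛ ys
  member y∈ = lose y∈ ≈-refl

  hasDifference : (δ : Carrier) → Decidable (λ (p : Carrier × Carrier) → proj₁ p - proj₂ p ≈ δ)
  hasDifference δ p = (proj₁ p - proj₂ p) ≈? δ

  pairsWith : (j i : Fin m) → Carrier → Dec (i ≡ j) → List (Carrier × Carrier)
  pairsWith j i a (yes _) = []
  pairsWith j i a (no _)  = map (a ,_) (A i)

  row : Fin m → Carrier → List (Carrier × Carrier)
  row j a = concatMap (λ i → pairsWith j i a (i ≟ᶠ j)) (allFin m)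

  -- crossPairs is built from a local helper; naming it as a witness lets
  -- us identify it with pairsWith.
  crossPairs-shape : ∀ j → Σ (Fin m → Carrier → List (Carrier × Carrier)) λ h →
    crossPairs G A j ≡ concatMap (λ a → concatMap (λ i → h i a) (allFin m)) (A j)
  crossPairs-shape j = _ , refl

  crossPairs-rows : ∀ j → crossPairs G A j ≡ concatMap (row j) (A j)
  crossPairs-rows j = trans (proj₂ (crossPairs-shape j))
    (concatMap-cong (λ a → concatMap-cong (λ i → helper≡pairsWith i a) (allFin m)) (A j))
    where
    helper≡pairsWith : ∀ i a → proj₁ (crossPairs-shape j) i a ≡ pairsWith j i a (i ≟ᶠ j)
    helper≡pairsWith i a with i ≟ᶠ j
    ... | yes _ = refl
    ... | no _  = refl

  partners : Fin m → Carrier → Carrier → ℕ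
  partners j δ a = length (filter (hasDifference δ) (row j a))

  N-by-rows : ∀ j δ → N G A j δ ≡ sum (map (partners j δ) (A j))
  N-by-rows j δ = trans (cong (λ ps → length (filter (hasDifference δ) ps)) (crossPairs-rows j))
    (length-filter-concatMap (hasDifference δ) (row j) (A j))

  ∈-pairsWith⁻ : ∀ {j i a u} d → u ∈ₚ pairsWith j i a d → ¬ i ≡ j × ∃ λ b → b ∈ₚ A i × u ≡ (a , b)
  ∈-pairsWith⁻ (no i≢j) u∈ = i≢j , ∈-map⁻ _ u∈

  ∈-pairsWith⁺ : ∀ {j i a b} d → ¬ i ≡ j → b ∈ₚ A i → (a , b) ∈ₚ pairsWith j i a d
  ∈-pairsWith⁺ (yes i≡j) i≢j _ = ⊥-elim (i≢j i≡j)
  ∈-pairsWith⁺ (no _)    _   b∈ = ∈-map⁺ _ b∈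

  ∈-row⁻ : ∀ {j a u} → u ∈ₚ row j a → ∃ λ k → ¬ k ≡ j × ∃ λ b → b ∈ₚ A k × u ≡ (a , b)
  ∈-row⁻ {j} {a} u∈ =
    let k , _ , u∈k = find (∈-concatMap⁻ (λ i → pairsWith j i a (i ≟ᶠ j)) {xs = allFin m} u∈)
    in k , ∈-pairsWith⁻ (k ≟ᶠ j) u∈k

  ∈-row⁺ : ∀ {j k a b} → ¬ k ≡ j → b ∈ₚ A k → (a , b) ∈ₚ row j a
  ∈-row⁺ {j} {k} {a} k≢j b∈ = ∈-concatMap⁺ (λ i → pairsWith j i a (i ≟ᶠ j)) {xs = allFin m}
    (Any.map (λ { refl → ∈-pairsWith⁺ (k ≟ᶠ j) k≢j b∈ }) (∈-allFin k))

  ∈-crossPairs⁻ : ∀ {j u} → u ∈ₚ crossPairs G A j →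
    ∃ λ a → a ∈ₚ A j × ∃ λ k → ¬ k ≡ j × ∃ λ b → b ∈ₚ A k × u ≡ (a , b)
  ∈-crossPairs⁻ {j} u∈ rewrite crossPairs-rows j =
    let a , a∈ , u∈row = find (∈-concatMap⁻ (row j) {xs = A j} u∈)
    in a , a∈ , ∈-row⁻ u∈row

  ∈-crossPairs⁺ : ∀ {j k a b} → a ∈ₚ A j → ¬ k ≡ j → b ∈ₚ A k → (a , b) ∈ₚ crossPairs G A j
  ∈-crossPairs⁺ {j} a∈ k≢j b∈ rewrite crossPairs-rows j =
    ∈-concatMap⁺ (row j) (Any.map (λ { refl → ∈-row⁺ k≢j b∈ }) a∈)

  HasPartner : Fin m → Carrier → Carrier → Set (c ⊔ ℓ)
  HasPartner j δ a = ∃ λ k → ¬ k ≡ j × ∃ λ b → b ∈ₚ A k × a - b ≈ δ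

  Outside : Fin m → Carrier → Set (c ⊔ ℓ)
  Outside i y = ∃ λ k → ¬ k ≡ i × y ∈ₛ A k

  Outside-resp : ∀ {i y y′} → y ≈ y′ → Outside i y → Outside i y′
  Outside-resp y≈y′ (k , k≢i , y∈) = k , k≢i , Any.map (≈-trans (≈-sym y≈y′)) y∈

  Preserves : Fin m → Carrier → Set (c ⊔ ℓ)
  Preserves i x = ∀ {y} → Outside i y → Outside i (y ∙ x)

  Preserves-resp : ∀ {i x x′} → x ≈ x′ → Preserves i x → Preserves i x′
  Preserves-resp x≈x′ preserves y∈ = Outside-resp (∙-congˡ x≈x′) (preserves y∈)

  Preserves-ε : ∀ {i} → Preserves i ε
  Preserves-ε {y = y} = Outside-resp (≈-sym (identityʳ y))

  Preserves-∙ : ∀ {i x x′} → Preserves i x → Preserves i x′ → Preserves i (x ∙ x′)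
  Preserves-∙ preserves preserves′ y∈ = Outside-resp (assoc _ _ _) (preserves′ (preserves y∈))

  module Distinct (distinct : ∀ i → IsSubsetList G (A i)) (disjoint : PairwiseDisjoint G A) where

    DistinctSecond : Carrier × Carrier → Carrier × Carrier → Set ℓ
    DistinctSecond u v = ¬ proj₂ u ≈ proj₂ v

    pairsWith-distinct : ∀ j i a d → AllPairs DistinctSecond (pairsWith j i a d)
    pairsWith-distinct j i a (yes _) = AllPairs.[]
    pairsWith-distinct j i a (no _)  = AllPairs.map⁺ (distinct i)

    pairsWith-apart : ∀ {j a i i′} → ¬ i ≡ i′ → ∀ {u v} →
      u ∈ₚ pairsWith j i a (i ≟ᶠ j) → v ∈ₚ pairsWith j i′ a (i′ ≟ᶠ j) → DistinctSecond u v
    pairsWith-apart {j} {a} {i} {i′} i≢i′ u∈ v∈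
      with ∈-pairsWith⁻ (i ≟ᶠ j) u∈ | ∈-pairsWith⁻ (i′ ≟ᶠ j) v∈
    ... | _ , b , b∈ , refl | _ , b′ , b′∈ , refl =
      λ b≈b′ → disjoint i i′ i≢i′ b (member b∈) (lose b′∈ b≈b′)

    row-distinct : ∀ j a → AllPairs DistinctSecond (row j a)
    row-distinct j a = AllPairs.concat⁺
      (AllProps.map⁺ (All.tabulate (λ {i} _ → pairsWith-distinct j i a (i ≟ᶠ j))))
      (AllPairs.map⁺ (AllPairs.map
        (λ i≢i′ → All.tabulate (λ u∈ → All.tabulate (λ v∈ → pairsWith-apart i≢i′ u∈ v∈)))
        (allFin⁺ m)))

    -- Partners at a fixed difference have equal second components, so a
    -- row contains at most one of them.
    partners≤1 : ∀ j δ a → partners j δ a ≤ 1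
    partners≤1 j δ a = length≤1 _ (AllPairs.filter⁺ (hasDifference δ) (row-distinct j a)) same-second
      where
      same-second : ∀ {u v} → u ∈ₚ filter (hasDifference δ) (row j a) →
        v ∈ₚ filter (hasDifference δ) (row j a) → ¬ DistinctSecond u v
      same-second u∈ v∈ with ∈-filter⁻ (hasDifference δ) u∈ | ∈-filter⁻ (hasDifference δ) v∈
      ... | u∈row , du | v∈row , dv with ∈-row⁻ u∈row | ∈-row⁻ v∈row
      ... | _ , _ , _ , _ , refl | _ , _ , _ , _ , refl =
        λ apart → apart (difference-injective a (≈-trans du (≈-sym dv)))

    N<size : ∀ {j δ a} → a ∈ₚ A j → partners j δ a ≡ 0 → N G A j δ < length (A j)
    N<size {j} {δ} a∈ none = subst (_< length (A j)) (sym (N-by-rows j δ))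
      (sum<length (partners j δ) (A j) (λ a _ → partners≤1 j δ a) a∈ none)

    module Bimodality (bimodal : Bimodal G A) where

      partner-everywhere : ∀ {j δ a₁} → ¬ δ ≈ ε → a₁ ∈ₚ A j → HasPartner j δ a₁ →
        ∀ {a} → a ∈ₚ A j → HasPartner j δ a
      partner-everywhere {j} {δ} δ≉ε a₁∈ (k , k≢j , b₁ , b₁∈ , diff₁) {a} a∈
        with filter-empty-or-witness (hasDifference δ) (row j a)
      ... | inj₂ (u , u∈ , diff) with ∈-row⁻ u∈
      ...   | k′ , k′≢j , b , b∈ , refl = k′ , k′≢j , b , b∈ , diff
      partner-everywhere {j} {δ} δ≉ε a₁∈ (k , k≢j , b₁ , b₁∈ , diff₁) {a} a∈
          | inj₁ no-partner with bimodal j δ δ≉ε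
      ... | inj₁ N≡0    = ⊥-elim (<-irrefl (sym N≡0)
                            (∈-length (∈-filter⁺ (hasDifference δ) (∈-crossPairs⁺ a₁∈ k≢j b₁∈) diff₁)))
      ... | inj₂ N≡size = ⊥-elim (<-irrefl N≡size (N<size a∈ (cong length no-partner)))

      -- Step 3: translation by a difference of two elements of Aᵢ maps Bᵢ
      -- into itself: g₂ has the partner y ∈ Bᵢ at difference g₂ - y ≠ 0,
      -- so g₁ has a partner b with g₁ - b = g₂ - y, i.e. b = y + (g₁ - g₂).
      Preserves-difference : ∀ {i g₁ g₂} → g₁ ∈ₛ A i → g₂ ∈ₛ A i → Preserves i (g₁ - g₂)
      Preserves-difference {i} g₁∈ g₂∈ (k , k≢i , y∈)
        with find g₁∈ | find g₂∈ | find y∈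
      ... | g₁′ , g₁′∈ , g₁≈ | g₂′ , g₂′∈ , g₂≈ | y′ , y′∈ , y≈
        with partner-everywhere g₂′-y′≉ε g₂′∈ (k , k≢i , y′ , y′∈ , ≈-refl) g₁′∈
        where
        g₂′-y′≉ε : ¬ g₂′ - y′ ≈ ε
        g₂′-y′≉ε g₂′-y′≈ε = disjoint i k (λ i≡k → k≢i (sym i≡k)) g₂′ (member g₂′∈)
          (lose y′∈ (x∙y⁻¹≈ε⇒x≈y _ _ g₂′-y′≈ε))
      ... | k′ , k′≢i , b , b∈ , diff =
        k′ , k′≢i ,
        lose b∈ (≈-trans (∙-cong y≈ (∙-cong g₁≈ (⁻¹-cong g₂≈))) (equal-differences diff))

      InH⇒Preserves : ∀ {i x} → InH G A i x → Preserves i x × Preserves i (x ⁻¹)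
      InH⇒Preserves (gen g₁ g₂ g₁∈ g₂∈ _ x≈) =
        Preserves-resp (≈-sym x≈) (Preserves-difference g₁∈ g₂∈) ,
        Preserves-resp (≈-sym (≈-trans (⁻¹-cong x≈) (⁻¹-anti-homo‿- g₁ g₂)))
          (Preserves-difference g₂∈ g₁∈)
      InH⇒Preserves (zero x≈ε) =
        Preserves-resp (≈-sym x≈ε) Preserves-ε ,
        Preserves-resp (≈-sym (≈-trans (⁻¹-cong x≈ε) ε⁻¹≈ε)) Preserves-ε
      InH⇒Preserves (add x∈ y∈ z≈) with InH⇒Preserves x∈ | InH⇒Preserves y∈
      ... | px , px⁻¹ | py , py⁻¹ =
        Preserves-resp (≈-sym z≈) (Preserves-∙ px py) ,
        Preserves-resp (≈-sym (≈-trans (⁻¹-cong z≈) (≈-sym (⁻¹-∙-comm _ _))))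
          (Preserves-∙ px⁻¹ py⁻¹)
      InH⇒Preserves (neg x∈ z≈) with InH⇒Preserves x∈
      ... | px , px⁻¹ =
        Preserves-resp (≈-sym z≈) px⁻¹ ,
        Preserves-resp (≈-sym (≈-trans (⁻¹-cong z≈) (⁻¹-involutive _))) px

      -- Step 4: a cross pair (a , b) with a - b = x ∈ Hᵢ would put
      -- a = b + x into Bᵢ, contradicting disjointness.
      N-vanishes-on-H : ∀ {i x} → InH G A i x → N G A i x ≡ 0
      N-vanishes-on-H {i} {x} x∈H with filter-empty-or-witness (hasDifference x) (crossPairs G A i)
      ... | inj₁ no-pair = cong length no-pair
      ... | inj₂ (u , u∈ , diff) with ∈-crossPairs⁻ u∈
      ...   | a , a∈ , k , k≢i , b , b∈ , refl with proj₁ (InH⇒Preserves x∈H) (k , k≢i , member b∈)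
      ...     | k′ , k′≢i , b+x∈ = ⊥-elim (disjoint i k′ (λ i≡k′ → k′≢i (sym i≡k′)) a (member a∈)
                  (Any.map (≈-trans (≈-sym (add-difference diff))) b+x∈))

mainTheorem11 : {c ℓ : Level} (G : FiniteAbelianGroup c ℓ) (m : ℕ)
    (A : Fin m → List (FiniteAbelianGroup.Carrier G)) →
    (∀ i → IsSubsetList G (A i)) →
    (∀ i → NonEmpty G (A i)) →
    PairwiseDisjoint G A →
    Bimodal G A →
    ∀ i x → InH G A i x → ¬ FiniteAbelianGroup._≈_ G x (FiniteAbelianGroup.ε G) →
    N G A i x ≡ 0
mainTheorem11 G m A distinct _ disjoint bimodal i x x∈H _ =
  Blocks.Distinct.Bimodality.N-vanishes-on-H G A distinct disjoint bimodal x∈H
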